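{- Let $a_m=\lfloor(\sqrt{2m-1}-1)/2\rfloor$ and $b_m=\lfloor\sqrt{m/2}\rfloor$. For every integer $m\ge2$: (a) $a_m\le b_m\le a_m+1$; (b) $b_m=\lfloor m/\sqrt{2m-1}\rfloor$; (c) $a_m+b_m=\lfloor\sqrt{2m}\rfloor-1$.
   Context: $\lfloor x\rfloor$ denotes the greatest integer not exceeding $x$. -}

module Defs where

open import Data.Nat using (ℕ; _+_; _*_; _∸_; _≤_; _<_)
open import Data.Product using (_×_)

-- A natural k is the floor of a nonnegative real x iff
-- k ≤ x < k + 1.  Since there are no reals in agda-stdlib, each inequality
-- between k (resp. k+1) and an expression involving a square root is
-- written out by squaring both (nonnegative) sides, which is an exact
-- equivalence.

-- k = ⌊ (√(2m-1) - 1) / 2 ⌋ :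
--   2k+1 ≤ √(2m-1)  and  √(2m-1) < 2(k+1)+1
IsA : ℕ → ℕ → Set
IsA m k = ((2 * k + 1) * (2 * k + 1) ≤ 2 * m ∸ 1)
        × (2 * m ∸ 1 < (2 * k + 3) * (2 * k + 3))

-- k = ⌊ √(m/2) ⌋ :  k ≤ √(m/2) < k+1,  i.e.  2k² ≤ m < 2(k+1)²
IsB : ℕ → ℕ → Set
IsB m k = (2 * (k * k) ≤ m) × (m < 2 * ((k + 1) * (k + 1)))

-- k = ⌊ m / √(2m-1) ⌋ :  k √(2m-1) ≤ m < (k+1) √(2m-1)
IsFloorMOverSqrt : ℕ → ℕ → Set
IsFloorMOverSqrt m k = ((k * k) * (2 * m ∸ 1) ≤ m * m)
                     × (m * m < ((k + 1) * (k + 1)) * (2 * m ∸ 1))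

IsFloorSqrt : ℕ → ℕ → Set
IsFloorSqrt n k = (k * k ≤ n) × (n < (k + 1) * (k + 1))

{-# OPTIONS --safe #-}
module Submission where

-- Squaring out the roots, IsA m a says 2a(a+1) < m ≤ 2(a+1)(a+2).  This
-- range splits at 2(a+1)² into the part where b = a and the part where
-- b = a + 1, and on these parts ⌊√(2m)⌋ is 2a+1 and 2a+2 respectively.
-- Part (b) depends only on b: with c = (b+1)² and e = 2c − m ≥ 1 we have
-- 2cm − m² = me ≥ m + e − 1 = 2c − 1 > c, i.e. m² < c(2m − 1).

open import Defs
open import Data.List using ([]; _∷_)
open import Data.Nat
  using (ℕ; suc; _+_; _*_; _∸_; _≤_; _<_; s≤s; s≤s⁻¹; z<s; NonZero; >-nonZero)
open import Data.Nat.Properties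
open import Data.Nat.Tactic.RingSolver using (solve)
open import Data.Product using (_×_; _,_)
open import Data.Sum using (inj₁; inj₂)
open import Relation.Binary.Core using (_Preserves_⟶_)
open import Relation.Binary.Definitions using (tri<; tri≈; tri>)
open import Relation.Binary.PropositionalEquality using (_≡_; refl; cong; subst)
open import Relation.Nullary using (contradiction)

open ≤-Reasoning

IsFloorOf : (ℕ → ℕ) → ℕ → ℕ → Set
IsFloorOf f n k = (f k ≤ n) × (n < f (k + 1))

<⇒+1≤ : ∀ {i j} → i < j → i + 1 ≤ j
<⇒+1≤ {i} {j} = subst (_≤ j) (+-comm 1 i)

isFloorOf-unique : ∀ {f} → f Preserves _≤_ ⟶ _≤_ →
                   ∀ {n k l} → IsFloorOf f n k → IsFloorOf f n l → k ≡ l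
isFloorOf-unique mono {k = k} {l} (fk≤n , n<fk+1) (fl≤n , n<fl+1) with <-cmp k l
... | tri< k<l _ _ = contradiction (≤-trans (mono (<⇒+1≤ k<l)) fl≤n) (<⇒≱ n<fk+1)
... | tri≈ _ k≡l _ = k≡l
... | tri> _ _ l<k = contradiction (≤-trans (mono (<⇒+1≤ l<k)) fk≤n) (<⇒≱ n<fl+1)

isB-unique : ∀ {m b c} → IsB m b → IsB m c → b ≡ c
isB-unique = isFloorOf-unique (λ i≤j → *-monoʳ-≤ 2 (*-mono-≤ i≤j i≤j))

2*x+1≤2*m∸1⇒x<m : ∀ {x m} → 2 * x + 1 ≤ 2 * m ∸ 1 → x < m
2*x+1≤2*m∸1⇒x<m {x} {m} h = *-cancelˡ-< 2 x m (begin-strict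
  2 * x     <⟨ m<m+n (2 * x) z<s ⟩
  2 * x + 1 ≤⟨ h ⟩
  2 * m ∸ 1 ≤⟨ m∸n≤m (2 * m) 1 ⟩
  2 * m     ∎)

2*m∸1<2*x+1⇒m≤x : ∀ {x m} → 2 * m ∸ 1 < 2 * x + 1 → m ≤ x
2*m∸1<2*x+1⇒m≤x {x} {m} h = m<1+n⇒m≤n (*-cancelˡ-< 2 m (suc x) (begin-strict
  2 * m               ≤⟨ m≤n+m∸n (2 * m) 1 ⟩
  suc (2 * m ∸ 1)     ≤⟨ h ⟩
  2 * x + 1           <⟨ n<1+n (2 * x + 1) ⟩
  suc (2 * x + 1)     ≡⟨ solve (x ∷ []) ⟩
  2 * suc x           ∎))

isA-bounds : ∀ {m a} → IsA m a → 2 * (a * (a + 1)) < m × m ≤ 2 * ((a + 1) * (a + 2))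
isA-bounds {m} {a} (lo , hi) = 2*x+1≤2*m∸1⇒x<m lo′ , 2*m∸1<2*x+1⇒m≤x hi′
  where
  lo′ : 2 * (2 * (a * (a + 1))) + 1 ≤ 2 * m ∸ 1
  lo′ = begin
    2 * (2 * (a * (a + 1))) + 1 ≡⟨ solve (a ∷ []) ⟩
    (2 * a + 1) * (2 * a + 1)   ≤⟨ lo ⟩
    2 * m ∸ 1                   ∎
  hi′ : 2 * m ∸ 1 < 2 * (2 * ((a + 1) * (a + 2))) + 1
  hi′ = begin-strict
    2 * m ∸ 1                         <⟨ hi ⟩
    (2 * a + 3) * (2 * a + 3)         ≡⟨ solve (a ∷ []) ⟩
    2 * (2 * ((a + 1) * (a + 2))) + 1 ∎

isB-self : ∀ {m a} → 2 * (a * (a + 1)) < m → m < 2 * ((a + 1) * (a + 1)) → IsB m a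
isB-self {a = a} lo hi = ≤-trans (*-monoʳ-≤ 2 (*-monoʳ-≤ a (m≤m+n a 1))) (<⇒≤ lo) , hi

isB-next : ∀ {m a} → 2 * ((a + 1) * (a + 1)) ≤ m → m ≤ 2 * ((a + 1) * (a + 2)) →
           IsB m (a + 1)
isB-next {m} {a} lo hi = lo , (begin-strict
  m                                         ≤⟨ hi ⟩
  2 * ((a + 1) * (a + 2))                   <⟨ m<m+n _ z<s ⟩
  2 * ((a + 1) * (a + 2)) + suc (2 * a + 3) ≡⟨ solve (a ∷ []) ⟩
  2 * ((a + 1 + 1) * (a + 1 + 1))           ∎)

isFloorSqrt-double-odd : ∀ {m a} → 2 * (a * (a + 1)) < m → m < 2 * ((a + 1) * (a + 1)) →
                         IsFloorSqrt (2 * m) (a + a + 1)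
isFloorSqrt-double-odd {m} {a} lo hi = lower , upper
  where
  lower : (a + a + 1) * (a + a + 1) ≤ 2 * m
  lower = begin
    (a + a + 1) * (a + a + 1)       ≤⟨ n≤1+n _ ⟩
    suc ((a + a + 1) * (a + a + 1)) ≡⟨ solve (a ∷ []) ⟩
    2 * suc (2 * (a * (a + 1)))     ≤⟨ *-monoʳ-≤ 2 lo ⟩
    2 * m                           ∎
  upper : 2 * m < (a + a + 1 + 1) * (a + a + 1 + 1)
  upper = begin-strict
    2 * m                           <⟨ *-monoʳ-< 2 hi ⟩
    2 * (2 * ((a + 1) * (a + 1)))   ≡⟨ solve (a ∷ []) ⟩
    (a + a + 1 + 1) * (a + a + 1 + 1) ∎

isFloorSqrt-double-even : ∀ {m a} → 2 * ((a + 1) * (a + 1)) ≤ m →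
                          m ≤ 2 * ((a + 1) * (a + 2)) →
                          IsFloorSqrt (2 * m) (a + (a + 1) + 1)
isFloorSqrt-double-even {m} {a} lo hi = lower , upper
  where
  lower : (a + (a + 1) + 1) * (a + (a + 1) + 1) ≤ 2 * m
  lower = begin
    (a + (a + 1) + 1) * (a + (a + 1) + 1) ≡⟨ solve (a ∷ []) ⟩
    2 * (2 * ((a + 1) * (a + 1)))         ≤⟨ *-monoʳ-≤ 2 lo ⟩
    2 * m                                 ∎
  upper : 2 * m < (a + (a + 1) + 1 + 1) * (a + (a + 1) + 1 + 1)
  upper = begin-strict
    2 * m                                         ≤⟨ *-monoʳ-≤ 2 hi ⟩
    2 * (2 * ((a + 1) * (a + 2)))                 <⟨ n<1+n _ ⟩
    suc (2 * (2 * ((a + 1) * (a + 2))))           ≡⟨ solve (a ∷ []) ⟩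
    (a + (a + 1) + 1 + 1) * (a + (a + 1) + 1 + 1) ∎

m+n≤1+m*n : ∀ m n .{{_ : NonZero m}} .{{_ : NonZero n}} → m + n ≤ suc (m * n)
m+n≤1+m*n (suc m) (suc n) = s≤s (begin
  m + suc n         ≡⟨ +-comm m (suc n) ⟩
  suc n + m         ≤⟨ +-monoʳ-≤ (suc n) (m≤m*n m (suc n)) ⟩
  suc n + m * suc n ∎)

m*m+c<c*2m : ∀ {m c} → 2 ≤ m → m < 2 * c → m * m + c < c * (2 * m)
m*m+c<c*2m {m} {c} 2≤m m<2c = begin-strict
  m * m + c     <⟨ +-monoʳ-< (m * m) c<m*e ⟩
  m * m + m * e ≡⟨ *-distribˡ-+ m m e ⟨
  m * (m + e)   ≡⟨ cong (m *_) (m+[n∸m]≡n (<⇒≤ m<2c)) ⟩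
  m * (2 * c)   ≡⟨ solve (m ∷ c ∷ []) ⟩
  c * (2 * m)   ∎
  where
  e : ℕ
  e = 2 * c ∸ m
  0<m : 0 < m
  0<m = ≤-trans z<s 2≤m
  2≤c : 2 ≤ c
  2≤c = *-cancelˡ-< 2 1 c (≤-<-trans 2≤m m<2c)
  c<m*e : c < m * e
  c<m*e = s≤s⁻¹ (begin
    suc (suc c) ≤⟨ +-monoˡ-≤ c 2≤c ⟩
    c + c       ≡⟨ solve (c ∷ []) ⟩
    2 * c       ≡⟨ m+[n∸m]≡n (<⇒≤ m<2c) ⟨
    m + e       ≤⟨ m+n≤1+m*n m e {{>-nonZero 0<m}} {{>-nonZero (m<n⇒0<n∸m m<2c)}} ⟩
    suc (m * e) ∎)

m*m<c*[2m∸1] : ∀ {m c} → 2 ≤ m → m < 2 * c → m * m < c * (2 * m ∸ 1)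
m*m<c*[2m∸1] {m} {c} 2≤m m<2c = begin-strict
  m * m               <⟨ m+n≤o⇒m≤o∸n (suc (m * m)) {c} (m*m+c<c*2m 2≤m m<2c) ⟩
  c * (2 * m) ∸ c     ≡⟨ cong (c * (2 * m) ∸_) (*-identityʳ c) ⟨
  c * (2 * m) ∸ c * 1 ≡⟨ *-distribˡ-∸ c (2 * m) 1 ⟨
  c * (2 * m ∸ 1)     ∎

isB⇒isFloorMOverSqrt : ∀ {m b} → 2 ≤ m → IsB m b → IsFloorMOverSqrt m b
isB⇒isFloorMOverSqrt {m} {b} 2≤m (lo , hi) =
  lower , m*m<c*[2m∸1] {c = (b + 1) * (b + 1)} 2≤m hi
  where
  lower : b * b * (2 * m ∸ 1) ≤ m * m
  lower = begin
    b * b * (2 * m ∸ 1) ≤⟨ *-monoʳ-≤ (b * b) (m∸n≤m (2 * m) 1) ⟩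
    b * b * (2 * m)     ≡⟨ solve (b ∷ m ∷ []) ⟩
    2 * (b * b) * m     ≤⟨ *-monoˡ-≤ m lo ⟩
    m * m               ∎

lemma5 : (m : ℕ) → 2 ≤ m → (a b : ℕ) → IsA m a → IsB m b →
    ((a ≤ b) × (b ≤ a + 1)) × IsFloorMOverSqrt m b × IsFloorSqrt (2 * m) (a + b + 1)
lemma5 m 2≤m a b isA isB with isA-bounds {m} {a} isA | <-≤-connex m (2 * ((a + 1) * (a + 1)))
... | lo , hi | inj₁ m<2[a+1]² with isB-unique {m} {b} {a} isB (isB-self {m} {a} lo m<2[a+1]²)
...   | refl = (≤-refl , m≤m+n a 1) , isB⇒isFloorMOverSqrt {m} {a} 2≤m isB ,
               isFloorSqrt-double-odd {m} {a} lo m<2[a+1]²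
lemma5 m 2≤m a b isA isB | lo , hi | inj₂ 2[a+1]²≤m
  with isB-unique {m} {b} {a + 1} isB (isB-next {m} {a} 2[a+1]²≤m hi)
...   | refl = (m≤m+n a 1 , ≤-refl) , isB⇒isFloorMOverSqrt {m} {a + 1} 2≤m isB ,
               isFloorSqrt-double-even {m} {a} 2[a+1]²≤m hi
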